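{- Let $U$ be a non-empty finite set of positive integers, $p=(p_1,p_2)$ with $p_1,p_2$ positive integers and $p_1+p_2=|U|$, $p'=(p_2,p_1)$, and let $H$ be a finite graph (loops and parallel edges allowed) with $U\subseteq V(H)$. Then $T\mapsto T^*$ is a bijection from $\bigcup_{G\in\mathcal{CT}_{U,p}(H)}\mathrm{ST}(G)$ to $\bigcup_{G\in\mathcal{CT}_{U,p'}(H)}\mathrm{ST}(G)$.
   Context: A tiered graph with two tiers is a simple graph $Q$ whose vertex set is a finite set of positive integers, together with a map $t:V(Q)\to\{1,2\}$ such that whenever $vv'\in E(Q)$ with $v>v'$ we have $t(v)>t(v')$; write $V_i(Q)=t^{ -1}(i)$. $\mathcal{CT}_{U,p}$ is the set of complete tiered graphs $Q$ with $V(Q)=U$, $|V_i(Q)|=p_i$, where complete means: for $u\in V_1(Q)$, $v\in V_2(Q)$, $uv\in E(Q)$ iff $u<v$ (no other edges). For $Q\in\mathcal{CT}_{U,p}$, $H\cup Q$ is the graph with vertex set $V(H)$ and edge set $E(H)\uplus E(Q)$ (edges of $H$ and of $Q$ always distinct), with designated sets $V_i(H\cup Q)=V_i(Q)$; $\mathcal{CT}_{U,p}(H)=\{H\cup Q:Q\in\mathcal{CT}_{U,p}\}$. $\mathrm{ST}(G)$ is the set of spanning trees of $G$, where a spanning tree $T$ of $G=H\cup Q$ is regarded as a quasi-tiered graph with designated sets $V_i(T)=V_i(Q)$; two such trees are different if their edge sets differ or their designated sets $V_1$ differ. Thus such $T$ can be written as $E_0\cup F$ with $E_0=E(T)\cap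 E(H)$ and $F$ the tiered forest with vertex set $U$, edge set $E(T)\cap E(Q)$ and tier sets $V_i(Q)$. Dual of a tiered graph: for a connected tiered graph $C$ with $V(C)=\{x_1<\cdots<x_s\}$ and tiering map $t$, its dual $C'$ has $V(C')=V(C)$, tiering map $t'(x_r)=3-t(x_{s+1-r})$, and $x_ix_j\in E(C')$ iff $x_{s+1-i}x_{s+1-j}\in E(C)$; for a general tiered graph $F$, $F'$ is obtained by dualizing each component separately. For $T=E_0\cup F$, $T^*$ is the quasi-tiered graph with vertex set $V(H)$, edge set $E_0\uplus E(F')$ and designated sets $V_i(F')$. -}

module Defs where

open import Data.Nat using (ℕ; zero; suc; _<_; _∸_; _<ᵇ_; _≤ᵇ_; _≡ᵇ_)
open import Data.Bool using (Bool; true; false; _∧_; _∨_; if_then_else_)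
open import Data.Fin using (Fin)
open import Data.Product using (_×_; _,_; proj₁; proj₂)
open import Data.Sum using (_⊎_)
open import Data.Maybe using (Maybe; just; nothing)
open import Data.List using (List; length; filterᵇ; findᵇ)
open import Data.Bool.ListAction using (any)
open import Data.List.Membership.Propositional using (_∈_)
open import Data.List.Relation.Unary.All using (All)
open import Data.List.Relation.Unary.Unique.Propositional using (Unique)
open import Relation.Binary.PropositionalEquality using (_≡_; _≢_)
open import Relation.Nullary using (¬_)

-- Finite multigraphs (loops and parallel edges allowed).
-- Vertex set: a finite set of natural numbers (duplicate-free list).
-- Edge set: Fin nE, each edge with an (unordered) pair of endpoints.

record Graph : Set where
  field
    verts  : List ℕ
    uniq   : Unique verts
    nE     : ℕ
    ends   : Fin nE → ℕ × ℕ
    endsIn : (e : Fin nE) → (proj₁ (ends e) ∈ verts) × (proj₂ (ends e) ∈ verts)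
open Graph public

data Tier : Set where
  t1 t2 : Tier

isT1 : Tier → Bool
isT1 t1 = true
isT1 t2 = false

isT2 : Tier → Bool
isT2 t1 = false
isT2 t2 = true

flipT : Tier → Tier
flipT t1 = t2
flipT t2 = t1

-- Raw quasi-tiered graph data on H ∪ Q  (vertex set V(H)):
--   tier : designated tiers (only values on U are meaningful),
--   hE   : the edge subset E₀ ⊆ E(H),
--   qE u v (for u < v, u v ∈ U) : whether the edge uv of Q is present.

record QT (H : Graph) : Set where
  field
    tier : ℕ → Tier
    hE   : Fin (nE H) → Bool
    qE   : ℕ → ℕ → Bool
open QT public

-- edges of H ∪ Q : edges of H, disjointly united with pairs (u , v), u < v
data Edge (H : Graph) : Set where
  hEdge : Fin (nE H) → Edge H
  qEdge : ℕ → ℕ → Edge H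

endpoints : {H : Graph} → Edge H → ℕ × ℕ
endpoints {H} (hEdge e) = ends H e
endpoints (qEdge u v) = u , v

Joins : {H : Graph} → Edge H → ℕ → ℕ → Set
Joins e x z = (endpoints e ≡ (x , z)) ⊎ (endpoints e ≡ (z , x))

data Walk {H : Graph} (P : Edge H → Set) : ℕ → ℕ → Set where
  stop : ∀ {x} → Walk P x x
  step : ∀ {x z y} (e : Edge H) → P e → Joins e x z → Walk P z y → Walk P x y

InT : (U : List ℕ) {H : Graph} → QT H → Edge H → Set
InT U T (hEdge e) = hE T e ≡ true
InT U T (qEdge u v) = (u ∈ U) × (v ∈ U) × (u < v) × (qE T u v ≡ true)

Connected : (H : Graph) → (Edge H → Set) → Set
Connected H P = ∀ x y → x ∈ verts H → y ∈ verts H → Walk P x y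

IsSpanningTree : (H : Graph) → (Edge H → Set) → Set
IsSpanningTree H P =
  Connected H P × (∀ e → P e → ¬ Connected H (λ f → P f × f ≢ e))

count : {A : Set} → (A → Bool) → List A → ℕ
count p xs = length (filterᵇ p xs)

-- T ∈ ⋃_{G ∈ CT_{U,(p₁,p₂)}(H)} ST(G):
--   the tiering on U has |V₁| = p₁, |V₂| = p₂ (this determines Q ∈ CT_{U,p}),
--   every chosen Q-edge uv (u < v) is an edge of Q (t u = 1, t v = 2),
--   and the chosen edges form a spanning tree of H ∪ Q.
InSTUnion : (U : List ℕ) (p₁ p₂ : ℕ) (H : Graph) → QT H → Set
InSTUnion U p₁ p₂ H T =
  (count (λ x → isT1 (tier T x)) U ≡ p₁) ×
  (count (λ x → isT2 (tier T x)) U ≡ p₂) ×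
  (∀ u v → u ∈ U → v ∈ U → u < v → qE T u v ≡ true →
     (tier T u ≡ t1) × (tier T v ≡ t2)) ×
  IsSpanningTree H (InT U T)

_≈[_]_ : {H : Graph} → QT H → List ℕ → QT H → Set
T ≈[ U ] S =
  (∀ x → x ∈ U → tier T x ≡ tier S x) ×
  (∀ e → hE T e ≡ hE S e) ×
  (∀ u v → u ∈ U → v ∈ U → u < v → qE T u v ≡ qE S u v)

module _ (U : List ℕ) (qe : ℕ → ℕ → Bool) where

  adjF : ℕ → ℕ → Bool
  adjF y z = ((y <ᵇ z) ∧ qe y z) ∨ ((z <ᵇ y) ∧ qe z y)

  reach : ℕ → ℕ → ℕ → Bool
  reach zero x y = y ≡ᵇ x
  reach (suc k) x y = reach k x y ∨ any (λ z → reach k x z ∧ adjF y z) U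

  comp : ℕ → List ℕ
  comp x = filterᵇ (reach (length U) x) U

  -- rank of y within the list of vertices c (1-based, increasing order)
  rankIn : List ℕ → ℕ → ℕ
  rankIn c y = count (λ w → w ≤ᵇ y) c

  -- if x = x_r in its component {x_1 < ... < x_s}, mirror x = x_{s+1-r}
  mirror : ℕ → ℕ
  mirror x with findᵇ (λ y → rankIn (comp x) y ≡ᵇ (suc (length (comp x)) ∸ rankIn (comp x) x)) (comp x)
  ... | just y  = y
  ... | nothing = x

-- T* : same E₀, forest F replaced by its componentwise dual F'
dual : (U : List ℕ) {H : Graph} → QT H → QT H
dual U T = record
  { tier = λ x → flipT (tier T (mirror U (qE T) x))
  ; hE   = hE T
  ; qE   = λ x y → let a = mirror U (qE T) x ; b = mirror U (qE T) y in
                   if a <ᵇ b then qE T a b else qE T b a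
  }

module Submission where

-- Write F for the forest of Q-edges of T (vertex set U) and μ for the map sending the
-- r-th smallest vertex of a component of F to its r-th largest vertex; then F' = F*
-- has the edge {μ y, μ z} for each edge {y, z} of F.  The proof rests on one fact:
--   (★) μ is an isomorphism F' ≅ F that preserves every component.
-- Hence F' has the same components as F, its mirror map is μ again, and T** = T;
-- this gives injectivity and surjectivity.  That T* is again a spanning tree of a graph
-- of the other family also comes from (★): μ permutes U and swaps the tiers (so the tier
-- counts swap), it reverses the order inside components (so edges of F' still go
-- from tier 1 up to tier 2), walks of T transfer to walks of T* (connectivity), and a
-- walk of T* − e for a Q-edge e, after cutting out its excursions through the component
-- of e, maps under μ to a walk of T − μ(e) (minimality).

open import Data.Nat using (ℕ; zero; suc; _<_; _≤_; _∸_; _<ᵇ_; _≤ᵇ_; _≡ᵇ_; z≤n; s≤s; _+_; _≤?_; _≟_)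
open import Data.Nat.Properties
open import Data.Bool using (Bool; true; false; _∧_; _∨_; if_then_else_; not)
open import Data.Bool.Properties using (T-≡; ∨-comm; ∨-identityʳ)
open import Data.Bool.ListAction using (any; or)
open import Data.Product using (Σ; _×_; _,_; proj₁; proj₂)
open import Data.Product.Properties using (,-injectiveˡ; ,-injectiveʳ)
open import Data.Sum using (_⊎_; inj₁; inj₂)
open import Data.Empty using (⊥; ⊥-elim)
open import Data.Unit using (⊤; tt)
open import Data.Maybe using (just; nothing; fromMaybe)
open import Data.List using (List; []; _∷_; length; filterᵇ; findᵇ; map)
open import Data.List.Properties using (map-cong-local; length-filter)
open import Data.List.Membership.Propositional using (_∈_; find; lose)
open import Data.List.Membership.Propositional.Properties using (∈-map⁺; ∈-map⁻; ∈-filter⁺; ∈-filter⁻)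
open import Data.List.Membership.Propositional.Properties.WithK using (unique∧set⇒bag)
open import Data.List.Relation.Unary.All using (All)
import Data.List.Relation.Unary.All as All
open import Data.List.Relation.Unary.Any using (here; there)
open import Data.List.Relation.Unary.Any.Properties using (any⁺; any⁻)
open import Data.List.Relation.Unary.AllPairs using ([]; _∷_)
open import Data.List.Relation.Unary.Unique.Propositional using (Unique)
import Data.List.Relation.Unary.Unique.Propositional.Properties as UniqueProps
open import Data.List.Relation.Binary.BagAndSetEquality using (∼bag⇒↭)
open import Data.List.Relation.Binary.Permutation.Propositional using (_↭_)
open import Data.List.Relation.Binary.Permutation.Propositional.Properties using (↭-length; filter-↭)
import Data.Fin as Fin
open import Function.Base using (_∘_)
open import Function.Bundles using (Equivalence; mk⇔)
open import Relation.Binary.Definitions using (tri<; tri≈; tri>)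
open import Relation.Binary.PropositionalEquality
open import Relation.Nullary using (¬_; Dec; yes; no)
open import Relation.Nullary.Decidable using (T?)
open import Defs

bool-clash : ∀ {a} → a ≡ true → a ≡ false → ⊥
bool-clash refl ()

bool-cases : ∀ b → b ≡ true ⊎ b ≡ false
bool-cases true = inj₁ refl
bool-cases false = inj₂ refl

bool-ext : ∀ {a b} → (a ≡ true → b ≡ true) → (b ≡ true → a ≡ true) → a ≡ b
bool-ext {true} f g = sym (f refl)
bool-ext {false} {true} f g = g refl
bool-ext {false} {false} f g = refl

∨-true : ∀ {a b} → a ∨ b ≡ true → a ≡ true ⊎ b ≡ true
∨-true {true} _ = inj₁ refl
∨-true {false} e = inj₂ e

∨-introˡ : ∀ {a} b → a ≡ true → a ∨ b ≡ true
∨-introˡ b refl = refl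

∨-introʳ : ∀ a {b} → b ≡ true → a ∨ b ≡ true
∨-introʳ true _ = refl
∨-introʳ false e = e

∧-true : ∀ {a b} → a ∧ b ≡ true → a ≡ true × b ≡ true
∧-true {true} e = refl , e

∧-intro : ∀ {a b} → a ≡ true → b ≡ true → a ∧ b ≡ true
∧-intro refl e = e

<ᵇ-true : ∀ {m n} → m < n → (m <ᵇ n) ≡ true
<ᵇ-true p = Equivalence.to T-≡ (<⇒<ᵇ p)

<ᵇ-true⁻ : ∀ {m n} → (m <ᵇ n) ≡ true → m < n
<ᵇ-true⁻ {m} {n} e = <ᵇ⇒< m n (Equivalence.from T-≡ e)

<ᵇ-false : ∀ {m n} → ¬ (m < n) → (m <ᵇ n) ≡ false
<ᵇ-false {m} {n} m≮n with m <ᵇ n in eq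
... | true = ⊥-elim (m≮n (<ᵇ-true⁻ eq))
... | false = refl

≤ᵇ-true : ∀ {m n} → m ≤ n → (m ≤ᵇ n) ≡ true
≤ᵇ-true p = Equivalence.to T-≡ (≤⇒≤ᵇ p)

≤ᵇ-true⁻ : ∀ {m n} → (m ≤ᵇ n) ≡ true → m ≤ n
≤ᵇ-true⁻ {m} {n} e = ≤ᵇ⇒≤ m n (Equivalence.from T-≡ e)

≤ᵇ-false : ∀ {m n} → ¬ (m ≤ n) → (m ≤ᵇ n) ≡ false
≤ᵇ-false {m} {n} m≰n with m ≤ᵇ n in eq
... | true = ⊥-elim (m≰n (≤ᵇ-true⁻ eq))
... | false = refl

≡ᵇ-true : ∀ {m n} → m ≡ n → (m ≡ᵇ n) ≡ true
≡ᵇ-true {m} {n} e = Equivalence.to T-≡ (≡⇒≡ᵇ m n e)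

≡ᵇ-true⁻ : ∀ {m n} → (m ≡ᵇ n) ≡ true → m ≡ n
≡ᵇ-true⁻ {m} {n} e = ≡ᵇ⇒≡ m n (Equivalence.from T-≡ e)

<ᵇ-swap : ∀ a b → a ≢ b → (b <ᵇ a) ≡ not (a <ᵇ b)
<ᵇ-swap a b a≢b with <-cmp a b
... | tri< a<b _ _ rewrite <ᵇ-true a<b | <ᵇ-false (<⇒≯ a<b) = refl
... | tri≈ _ a≡b _ = ⊥-elim (a≢b a≡b)
... | tri> _ _ b<a rewrite <ᵇ-true b<a | <ᵇ-false (<⇒≯ b<a) = refl

<ᵇ-false⇒> : ∀ {a b} → a ≢ b → (a <ᵇ b) ≡ false → b < a
<ᵇ-false⇒> {a} {b} a≢b e = <ᵇ-true⁻ (trans (<ᵇ-swap a b a≢b) (cong not e))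

or-as-if : ∀ a b (f : ℕ → ℕ → Bool) → a ≢ b →
  ((a <ᵇ b) ∧ f a b) ∨ ((b <ᵇ a) ∧ f b a) ≡ (if a <ᵇ b then f a b else f b a)
or-as-if a b f a≢b rewrite <ᵇ-swap a b a≢b with a <ᵇ b
... | true = ∨-identityʳ (f a b)
... | false = refl

if-swap : ∀ a b {A : Set} (X Y : A) → a ≢ b → (if b <ᵇ a then X else Y) ≡ (if a <ᵇ b then Y else X)
if-swap a b X Y a≢b rewrite <ᵇ-swap a b a≢b with a <ᵇ b
... | true = refl
... | false = refl

if-same : ∀ {A : Set} (b : Bool) (x : A) → (if b then x else x) ≡ x
if-same true x = refl
if-same false x = refl

any-witness : ∀ {A : Set} (p : A → Bool) xs → any p xs ≡ true → Σ A λ x → x ∈ xs × p x ≡ true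
any-witness p xs e with find (any⁻ p xs (Equivalence.from T-≡ e))
... | x , x∈xs , px = x , x∈xs , Equivalence.to T-≡ px

any-intro : ∀ {A : Set} (p : A → Bool) {xs x} → x ∈ xs → p x ≡ true → any p xs ≡ true
any-intro p x∈xs e = Equivalence.to T-≡ (any⁺ p (lose x∈xs (Equivalence.from T-≡ e)))

any-cong : ∀ {A : Set} (p q : A → Bool) xs → (∀ x → x ∈ xs → p x ≡ q x) → any p xs ≡ any q xs
any-cong p q xs h = cong or (map-cong-local (All.tabulate (λ {x} → h x)))

filter-cong : ∀ {A : Set} (p q : A → Bool) xs → (∀ x → x ∈ xs → p x ≡ q x) → filterᵇ p xs ≡ filterᵇ q xs
filter-cong p q [] h = refl
filter-cong p q (x ∷ xs) h with p x in px | q x in qx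
... | true | true = cong (x ∷_) (filter-cong p q xs (λ y m → h y (there m)))
... | false | false = filter-cong p q xs (λ y m → h y (there m))
... | true | false = ⊥-elim (bool-clash (trans (sym (h x (here refl))) px) qx)
... | false | true = ⊥-elim (bool-clash (trans (h x (here refl)) qx) px)

∈-filterᵇ⁺ : ∀ {A : Set} (p : A → Bool) {xs x} → x ∈ xs → p x ≡ true → x ∈ filterᵇ p xs
∈-filterᵇ⁺ p x∈xs e = ∈-filter⁺ (T? ∘ p) x∈xs (Equivalence.from T-≡ e)

∈-filterᵇ⁻ : ∀ {A : Set} (p : A → Bool) xs {x} → x ∈ filterᵇ p xs → x ∈ xs × p x ≡ true
∈-filterᵇ⁻ p xs x∈ with ∈-filter⁻ (T? ∘ p) {xs = xs} x∈
... | x∈xs , px = x∈xs , Equivalence.to T-≡ px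

findᵇ-just : ∀ {A : Set} (p : A → Bool) xs {y} → findᵇ p xs ≡ just y → y ∈ xs × p y ≡ true
findᵇ-just p (x ∷ xs) e with p x in px
findᵇ-just p (x ∷ xs) refl | true = here refl , px
... | false = let (y∈xs , py) = findᵇ-just p xs e in there y∈xs , py

findᵇ-nothing : ∀ {A : Set} (p : A → Bool) xs → findᵇ p xs ≡ nothing → ∀ y → y ∈ xs → p y ≡ false
findᵇ-nothing p (x ∷ xs) e y m with p x in px
findᵇ-nothing p (x ∷ xs) () y m | true
findᵇ-nothing p (x ∷ xs) e y (here refl) | false = px
findᵇ-nothing p (x ∷ xs) e y (there m) | false = findᵇ-nothing p xs e y m

count-cong : ∀ {A : Set} (p q : A → Bool) xs → (∀ x → x ∈ xs → p x ≡ q x) → count p xs ≡ count q xs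
count-cong p q xs h = cong length (filter-cong p q xs h)

count-≤ : ∀ {A : Set} (p : A → Bool) xs → count p xs ≤ length xs
count-≤ p xs = length-filter (T? ∘ p) xs

count-mono : ∀ {A : Set} (p q : A → Bool) xs → (∀ x → x ∈ xs → p x ≡ true → q x ≡ true) →
  count p xs ≤ count q xs
count-mono p q [] h = z≤n
count-mono p q (x ∷ xs) h with p x in px | q x in qx
... | true | true = s≤s (count-mono p q xs (λ y m → h y (there m)))
... | false | true = m≤n⇒m≤1+n (count-mono p q xs (λ y m → h y (there m)))
... | false | false = count-mono p q xs (λ y m → h y (there m))
... | true | false = ⊥-elim (bool-clash (h x (here refl) px) qx)

count-strict : ∀ {A : Set} (p q : A → Bool) xs → (∀ x → x ∈ xs → p x ≡ true → q x ≡ true) →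
  ∀ y → y ∈ xs → p y ≡ false → q y ≡ true → count p xs < count q xs
count-strict p q (x ∷ xs) h y (here refl) py qy rewrite py | qy =
  s≤s (count-mono p q xs (λ y m → h y (there m)))
count-strict p q (x ∷ xs) h y (there y∈xs) py qy with p x in px | q x in qx
... | true | true = s≤s (count-strict p q xs (λ y m → h y (there m)) y y∈xs py qy)
... | false | true = m≤n⇒m≤1+n (count-strict p q xs (λ y m → h y (there m)) y y∈xs py qy)
... | false | false = count-strict p q xs (λ y m → h y (there m)) y y∈xs py qy
... | true | false = ⊥-elim (bool-clash (h x (here refl) px) qx)

count-pos : ∀ {A : Set} (p : A → Bool) xs y → y ∈ xs → p y ≡ true → 0 < count p xs
count-pos p xs y y∈xs py = ≤-<-trans z≤n (count-strict (λ _ → false) p xs (λ _ _ ()) y y∈xs refl py)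

count-involution : ∀ U → Unique U → (g : ℕ → ℕ) → (∀ x → x ∈ U → g x ∈ U) →
  (∀ x → x ∈ U → g (g x) ≡ x) → ∀ (p : ℕ → Bool) → count (p ∘ g) U ≡ count p U
count-involution U uU g gU gg p = trans (count-map U) (↭-length (filter-↭ (T? ∘ p) gU↭U))
  where
  count-map : ∀ xs → count (p ∘ g) xs ≡ count p (map g xs)
  count-map [] = refl
  count-map (x ∷ xs) with p (g x)
  ... | true = cong suc (count-map xs)
  ... | false = count-map xs
  g-inj : ∀ a b → a ∈ U → b ∈ U → g a ≡ g b → a ≡ b
  g-inj a b aU bU e = trans (sym (gg a aU)) (trans (cong g e) (gg b bU))
  unique-map : ∀ xs → Unique xs → (∀ a b → a ∈ xs → b ∈ xs → g a ≡ g b → a ≡ b) → Unique (map g xs)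
  unique-map [] _ _ = []
  unique-map (x ∷ xs) (x∉xs ∷ u) inj =
    All.tabulate (λ ym e → let (z , z∈xs , y≡gz) = ∈-map⁻ g ym in
                   All.lookup x∉xs z∈xs (inj x z (here refl) (there z∈xs) (trans e y≡gz)))
    ∷ unique-map xs u (λ a b am bm → inj a b (there am) (there bm))
  gU↭U : map g U ↭ U
  gU↭U = ∼bag⇒↭ (unique∧set⇒bag (unique-map U uU g-inj) uU
    (λ {z} → mk⇔ (λ zm → let (w , wU , e) = ∈-map⁻ g zm in subst (_∈ U) (sym e) (gU w wU))
                 (λ zU → subst (_∈ map g U) (gg z zU) (∈-map⁺ g (gU z zU)))))

data Path (E : ℕ → ℕ → Set) : ℕ → ℕ → Set where
  pnil : ∀ {x} → Path E x x
  pcons : ∀ {x z y} → E x z → Path E z y → Path E x y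

pmap : ∀ {E E' : ℕ → ℕ → Set} (g : ℕ → ℕ) → (∀ {a b} → E a b → E' (g a) (g b)) →
  ∀ {x y} → Path E x y → Path E' (g x) (g y)
pmap g f pnil = pnil
pmap g f (pcons e p) = pcons (f e) (pmap g f p)

papp : ∀ {E : ℕ → ℕ → Set} {x y z} → Path E x y → Path E y z → Path E x z
papp pnil q = q
papp (pcons e p) q = pcons e (papp p q)

ptransport : ∀ {E : ℕ → ℕ → Set} (Q : ℕ → Set) → (∀ {a b} → E a b → Q a → Q b) →
  ∀ {x y} → Path E x y → Q x → Q y
ptransport Q f pnil q = q
ptransport Q f (pcons e p) q = ptransport Q f p (f e q)

adjF-sym : ∀ U qe y z → adjF U qe y z ≡ adjF U qe z y
adjF-sym U qe y z = ∨-comm ((y <ᵇ z) ∧ qe y z) ((z <ᵇ y) ∧ qe z y)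

module Components (U : List ℕ) (qe : ℕ → ℕ → Bool) where

  adj : ℕ → ℕ → Bool
  adj = adjF U qe

  ρ : ℕ → ℕ → ℕ → Bool
  ρ = reach U qe

  ρ-suc : ∀ k x y → ρ k x y ≡ true → ρ (suc k) x y ≡ true
  ρ-suc k x y e = ∨-introˡ _ e

  ρ-mono : ∀ k k' x y → k ≤ k' → ρ k x y ≡ true → ρ k' x y ≡ true
  ρ-mono k k' x y k≤k' e with m≤n⇒∃[o]m+o≡n k≤k'
  ... | o , refl = go o
    where
    go : ∀ o → ρ (k + o) x y ≡ true
    go zero rewrite +-identityʳ k = e
    go (suc o) rewrite +-suc k o = ρ-suc (k + o) x y (go o)

  ρ-refl : ∀ k x → ρ k x x ≡ true
  ρ-refl zero x = ≡ᵇ-true {x} refl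
  ρ-refl (suc k) x = ρ-suc k x x (ρ-refl k x)

  ρ-zero : ∀ x y → ρ 0 x y ≡ true → y ≡ x
  ρ-zero x y e = ≡ᵇ-true⁻ e

  ρ-extend : ∀ k x y z → z ∈ U → ρ k x z ≡ true → adj y z ≡ true → ρ (suc k) x y ≡ true
  ρ-extend k x y z zU e a = ∨-introʳ (ρ k x y) (any-intro (λ w → ρ k x w ∧ adj y w) zU (∧-intro e a))

  ρ-inv : ∀ k x y → ρ (suc k) x y ≡ true →
    ρ k x y ≡ true ⊎ Σ ℕ (λ z → z ∈ U × ρ k x z ≡ true × adj y z ≡ true)
  ρ-inv k x y e with ∨-true {ρ k x y} e
  ... | inj₁ e₁ = inj₁ e₁
  ... | inj₂ e₂ with any-witness (λ w → ρ k x w ∧ adj y w) U e₂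
  ... | z , zU , q = inj₂ (z , zU , ∧-true {ρ k x z} q)

  ρ-prepend : ∀ k x' x y → x' ∈ U → adj x' x ≡ true → ρ k x y ≡ true → ρ (suc k) x' y ≡ true
  ρ-prepend zero x' x y x'U a e with ρ-zero x y e
  ... | refl = ρ-extend 0 x' y x' x'U (ρ-refl 0 x') (trans (adjF-sym U qe y x') a)
  ρ-prepend (suc k) x' x y x'U a e with ρ-inv k x y e
  ... | inj₁ e₁ = ρ-suc (suc k) x' y (ρ-prepend k x' x y x'U a e₁)
  ... | inj₂ (z , zU , e₂ , a₂) = ρ-extend (suc k) x' y z zU (ρ-prepend k x' x z x'U a e₂) a₂

  ρ-sym : ∀ k x y → y ∈ U → ρ k x y ≡ true → ρ k y x ≡ true
  ρ-sym zero x y yU e with ρ-zero x y e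
  ... | refl = ρ-refl 0 x
  ρ-sym (suc k) x y yU e with ρ-inv k x y e
  ... | inj₁ e₁ = ρ-suc k y x (ρ-sym k x y yU e₁)
  ... | inj₂ (z , zU , e₂ , a₂) = ρ-prepend k y z x yU a₂ (ρ-sym k x z zU e₂)

  ρ-trans : ∀ a b x y z → ρ a x y ≡ true → ρ b y z ≡ true → ρ (b + a) x z ≡ true
  ρ-trans a zero x y z e₁ e₂ with ρ-zero y z e₂
  ... | refl = e₁
  ρ-trans a (suc b) x y z e₁ e₂ with ρ-inv b y z e₂
  ... | inj₁ e = ρ-suc (b + a) x z (ρ-trans a b x y z e₁ e)
  ... | inj₂ (w , wU , e , a') = ρ-extend (b + a) x z w wU (ρ-trans a b x y w e₁ e) a'

  -- Stabilisation: once one more step reaches nothing new, no further step does; and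
  -- this happens within |U| steps, since each non-stable step reaches a new vertex of U.
  Stable : ℕ → ℕ → Set
  Stable k x = ∀ z → z ∈ U → ρ (suc k) x z ≡ true → ρ k x z ≡ true

  stable-suc : ∀ k x → Stable k x → Stable (suc k) x
  stable-suc k x S y _ e with ρ-inv (suc k) x y e
  ... | inj₁ e₁ = e₁
  ... | inj₂ (z , zU , e₂ , a) = ρ-extend k x y z zU (S z zU e₂) a

  stable-+ : ∀ t k x → Stable k x → Stable (t + k) x
  stable-+ zero k x S = S
  stable-+ (suc t) k x S = stable-suc (t + k) x (stable-+ t k x S)

  stable-bound : ∀ j x → Stable j x → ∀ k y → y ∈ U → ρ k x y ≡ true → ρ j x y ≡ true
  stable-bound j x S zero y yU e = ρ-mono 0 j x y z≤n e
  stable-bound j x S (suc k) y yU e with suc k ≤? j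
  ... | yes k<j = ρ-mono (suc k) j x y k<j e
  ... | no k≮j with m≤n⇒∃[o]m+o≡n (≤-pred (≰⇒> k≮j))
  ... | o , eq = stable-bound j x S k y yU
        (subst (λ w → Stable w x) (trans (+-comm o j) eq) (stable-+ o j x S) y yU e)

  stable-or-growing : ∀ k x → x ∈ U → Σ ℕ (λ j → j ≤ k × Stable j x) ⊎ (k < count (ρ k x) U)
  stable-or-growing zero x xU = inj₂ (count-pos (ρ 0 x) U x xU (ρ-refl 0 x))
  stable-or-growing (suc k) x xU with stable-or-growing k x xU
  ... | inj₁ (j , j≤k , S) = inj₁ (j , m≤n⇒m≤1+n j≤k , S)
  ... | inj₂ grow with any (λ z → ρ (suc k) x z ∧ not (ρ k x z)) U in new
  ... | true with any-witness (λ z → ρ (suc k) x z ∧ not (ρ k x z)) U new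
  ... | z , zU , q with ∧-true {ρ (suc k) x z} q
  ... | q₁ , q₂ = inj₂ (≤-trans (s≤s grow)
          (count-strict (ρ k x) (ρ (suc k) x) U (λ y _ → ρ-suc k x y) z zU (not-true q₂) q₁))
    where
    not-true : ∀ {b} → not b ≡ true → b ≡ false
    not-true {false} _ = refl
  stable-or-growing (suc k) x xU | inj₂ grow | false = inj₁ (k , n≤1+n k , S)
    where
    S : Stable k x
    S z zU e with bool-cases (ρ k x z)
    ... | inj₁ t = t
    ... | inj₂ f = ⊥-elim (bool-clash (any-intro (λ z → ρ (suc k) x z ∧ not (ρ k x z)) zU
                   (∧-intro e (cong not f))) new)

  n : ℕ
  n = length U

  stabilise : ∀ k x y → x ∈ U → y ∈ U → ρ k x y ≡ true → ρ n x y ≡ true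
  stabilise k x y xU yU e with stable-or-growing n x xU
  ... | inj₂ grow = ⊥-elim (<⇒≱ grow (count-≤ (ρ n x) U))
  ... | inj₁ (j , j≤n , S) = ρ-mono j n x y j≤n (stable-bound j x S k y yU e)

  infix 4 _~_
  _~_ : ℕ → ℕ → Set
  x ~ y = ρ n x y ≡ true

  ~-refl : ∀ x → x ~ x
  ~-refl x = ρ-refl n x

  ~-sym : ∀ x y → y ∈ U → x ~ y → y ~ x
  ~-sym x y yU e = ρ-sym n x y yU e

  ~-trans : ∀ x y z → x ∈ U → z ∈ U → x ~ y → y ~ z → x ~ z
  ~-trans x y z xU zU e₁ e₂ = stabilise (n + n) x z xU zU (ρ-trans n n x y z e₁ e₂)

  adj⇒~ : ∀ y z → y ∈ U → z ∈ U → adj y z ≡ true → y ~ z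
  adj⇒~ y z yU zU a = stabilise 1 y z yU zU (ρ-extend 0 y z y yU (ρ-refl 0 y) (trans (adjF-sym U qe z y) a))

  BallEdge : ℕ → ℕ → ℕ → ℕ → Set
  BallEdge k x a b = adj a b ≡ true × a ∈ U × b ∈ U × ρ k x a ≡ true × ρ k x b ≡ true

  ball-widen : ∀ {k x a b} → BallEdge k x a b → BallEdge (suc k) x a b
  ball-widen {k} {x} (a , aU , bU , ra , rb) = a , aU , bU , ρ-suc k x _ ra , ρ-suc k x _ rb

  ball-path : ∀ k x y → x ∈ U → y ∈ U → ρ k x y ≡ true → Path (BallEdge k x) y x
  ball-path zero x y xU yU e with ρ-zero x y e
  ... | refl = pnil
  ball-path (suc k) x y xU yU e with ρ-inv k x y e
  ... | inj₁ e₁ = pmap (λ v → v) (ball-widen {k} {x}) (ball-path k x y xU yU e₁)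
  ... | inj₂ (z , zU , e₂ , a₂) = pcons (a₂ , yU , zU , e , ρ-suc k x z e₂)
                                        (pmap (λ v → v) (ball-widen {k} {x}) (ball-path k x z xU zU e₂))


  closer-neighbour : ∀ w x → w ~ x → x ≢ w →
    Σ ℕ λ k → Σ ℕ λ z → z ∈ U × ρ k w z ≡ true × ρ k w x ≡ false × adj x z ≡ true
  closer-neighbour w x w~x x≢w = first-step n w~x
    where
    first-step : ∀ k → ρ k w x ≡ true →
      Σ ℕ λ k → Σ ℕ λ z → z ∈ U × ρ k w z ≡ true × ρ k w x ≡ false × adj x z ≡ true
    first-step zero e = ⊥-elim (x≢w (ρ-zero w x e))
    first-step (suc k) e with bool-cases (ρ k w x) | ρ-inv k w x e
    ... | inj₁ t | _ = first-step k t
    ... | inj₂ f | inj₁ t = ⊥-elim (bool-clash t f)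
    ... | inj₂ f | inj₂ (z , zU , ρz , a) = k , z , zU , ρz , f , a

reach-map : ∀ U qe₁ qe₂ (g : ℕ → ℕ) → (∀ y → y ∈ U → g y ∈ U) →
  (∀ y z → y ∈ U → z ∈ U → adjF U qe₁ y z ≡ true → adjF U qe₂ (g y) (g z) ≡ true) →
  ∀ k x y → y ∈ U → reach U qe₁ k x y ≡ true → reach U qe₂ k (g x) (g y) ≡ true
reach-map U qe₁ qe₂ g gU gadj zero x y yU e with C₁.ρ-zero x y e
  where module C₁ = Components U qe₁
... | refl = Components.ρ-refl U qe₂ 0 (g x)
reach-map U qe₁ qe₂ g gU gadj (suc k) x y yU e with Components.ρ-inv U qe₁ k x y e
... | inj₁ e₁ = Components.ρ-suc U qe₂ k (g x) (g y) (reach-map U qe₁ qe₂ g gU gadj k x y yU e₁)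
... | inj₂ (z , zU , e₂ , a₂) = Components.ρ-extend U qe₂ k (g x) (g y) (g z) (gU z zU)
        (reach-map U qe₁ qe₂ g gU gadj k x z zU e₂) (gadj y z yU zU a₂)

Agree : List ℕ → (ℕ → ℕ → Bool) → (ℕ → ℕ → Bool) → Set
Agree U q₁ q₂ = ∀ u v → u ∈ U → v ∈ U → u < v → q₁ u v ≡ q₂ u v

adjF-cong : ∀ U q₁ q₂ → Agree U q₁ q₂ → ∀ y z → y ∈ U → z ∈ U → adjF U q₁ y z ≡ adjF U q₂ y z
adjF-cong U q₁ q₂ ag y z yU zU with y <ᵇ z in y<z | z <ᵇ y in z<y
... | true | true = cong₂ _∨_ (ag y z yU zU (<ᵇ-true⁻ y<z)) (ag z y zU yU (<ᵇ-true⁻ z<y))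
... | true | false = cong (_∨ false) (ag y z yU zU (<ᵇ-true⁻ y<z))
... | false | true = ag z y zU yU (<ᵇ-true⁻ z<y)
... | false | false = refl

reach-cong : ∀ U q₁ q₂ → Agree U q₁ q₂ → ∀ k x y → y ∈ U → reach U q₁ k x y ≡ reach U q₂ k x y
reach-cong U q₁ q₂ ag zero x y yU = refl
reach-cong U q₁ q₂ ag (suc k) x y yU =
  cong₂ _∨_ (reach-cong U q₁ q₂ ag k x y yU)
    (any-cong _ _ U (λ z zU → cong₂ _∧_ (reach-cong U q₁ q₂ ag k x z zU) (adjF-cong U q₁ q₂ ag y z yU zU)))

comp-cong : ∀ U q₁ q₂ → Agree U q₁ q₂ → ∀ x → comp U q₁ x ≡ comp U q₂ x
comp-cong U q₁ q₂ ag x = filter-cong _ _ U (λ z zU → reach-cong U q₁ q₂ ag (length U) x z zU)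

rank : List ℕ → ℕ → ℕ
rank c y = count (λ w → w ≤ᵇ y) c

rank-mono : ∀ c {a b} → a ≤ b → rank c a ≤ rank c b
rank-mono c {a} {b} a≤b = count-mono _ _ c (λ w _ e → ≤ᵇ-true (≤-trans (≤ᵇ-true⁻ {w} {a} e) a≤b))

rank-strict : ∀ c {a b} → a < b → b ∈ c → rank c a < rank c b
rank-strict c {a} {b} a<b b∈c =
  count-strict _ _ c (λ w _ e → ≤ᵇ-true (≤-trans (≤ᵇ-true⁻ {w} {a} e) (<⇒≤ a<b))) b b∈c
    (≤ᵇ-false (<⇒≱ a<b)) (≤ᵇ-true {b} ≤-refl)

rank-pos : ∀ c {y} → y ∈ c → 0 < rank c y
rank-pos c {y} y∈c = count-pos _ c y y∈c (≤ᵇ-true {y} ≤-refl)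

rank-≤ : ∀ c y → rank c y ≤ length c
rank-≤ c y = count-≤ _ c

rank-injective : ∀ c {a b} → a ∈ c → b ∈ c → rank c a ≡ rank c b → a ≡ b
rank-injective c {a} {b} a∈c b∈c e with <-cmp a b
... | tri< a<b _ _ = ⊥-elim (<-irrefl e (rank-strict c a<b b∈c))
... | tri≈ _ a≡b _ = a≡b
... | tri> _ _ b<a = ⊥-elim (<-irrefl (sym e) (rank-strict c b<a a∈c))

rank-cons-≤ : ∀ a c y → a ≤ y → rank (a ∷ c) y ≡ suc (rank c y)
rank-cons-≤ a c y a≤y rewrite ≤ᵇ-true a≤y = refl

rank-cons-> : ∀ a c y → y < a → rank (a ∷ c) y ≡ rank c y
rank-cons-> a c y y<a rewrite ≤ᵇ-false (<⇒≱ y<a) = refl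

rank-surjective : ∀ c → Unique c → ∀ r → 0 < r → r ≤ length c → Σ ℕ λ y → y ∈ c × rank c y ≡ r
rank-surjective [] _ r 0<r r≤0 = ⊥-elim (<-irrefl refl (≤-trans 0<r r≤0))
rank-surjective (a ∷ c) (a∉c ∷ u) r 0<r r≤ with <-cmp r (suc (rank c a))
... | tri≈ _ r≡ _ = a , here refl , trans (rank-cons-≤ a c a ≤-refl) (sym r≡)
... | tri< r< _ _ with rank-surjective c u r 0<r (≤-trans (≤-pred r<) (rank-≤ c a))
... | y , y∈c , ry with <-cmp y a
... | tri< y<a _ _ = y , there y∈c , trans (rank-cons-> a c y y<a) ry
... | tri≈ _ refl _ = ⊥-elim (All.lookup a∉c y∈c refl)
... | tri> _ _ a<y = ⊥-elim (<-irrefl refl (≤-trans r< (subst (suc (rank c a) ≤_) ry (rank-strict c a<y y∈c))))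
rank-surjective (a ∷ c) (a∉c ∷ u) (suc r) 0<r r≤ | tri> _ _ r> with rank-surjective c u r (≤-trans (s≤s z≤n) (≤-pred r>)) (≤-pred r≤)
... | y , y∈c , ry with <-cmp y a
... | tri< y<a _ _ = ⊥-elim (<-irrefl refl (≤-trans r> (s≤s (subst (_≤ rank c a) ry (rank-mono c (<⇒≤ y<a))))))
... | tri≈ _ refl _ = ⊥-elim (All.lookup a∉c y∈c refl)
... | tri> _ _ a<y = y , there y∈c , trans (rank-cons-≤ a c y (<⇒≤ a<y)) (cong suc ry)

mirrorRank : List ℕ → ℕ → ℕ
mirrorRank c x = suc (length c) ∸ rank c x

mirror-search : ∀ U qe x → mirror U qe x ≡
  fromMaybe x (findᵇ (λ y → rank (comp U qe x) y ≡ᵇ mirrorRank (comp U qe x) x) (comp U qe x))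
mirror-search U qe x with findᵇ (λ y → rank (comp U qe x) y ≡ᵇ mirrorRank (comp U qe x) x) (comp U qe x)
... | just y = refl
... | nothing = refl

mirror-comp : ∀ U q₁ q₂ x → comp U q₁ x ≡ comp U q₂ x → mirror U q₁ x ≡ mirror U q₂ x
mirror-comp U q₁ q₂ x e = trans (mirror-search U q₁ x)
  (trans (cong (λ c → fromMaybe x (findᵇ (λ y → rank c y ≡ᵇ mirrorRank c x) c)) e) (sym (mirror-search U q₂ x)))

module Mirror (U : List ℕ) (uU : Unique U) (qe : ℕ → ℕ → Bool) where
  open Components U qe public

  cp : ℕ → List ℕ
  cp x = comp U qe x

  μ : ℕ → ℕ
  μ x = mirror U qe x

  cp-unique : ∀ x → Unique (cp x)
  cp-unique x = UniqueProps.filter⁺ (T? ∘ ρ n x) uU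

  ∈cp : ∀ x → x ∈ U → x ∈ cp x
  ∈cp x xU = ∈-filterᵇ⁺ (ρ n x) xU (~-refl x)

  cp∈ : ∀ x {y} → y ∈ cp x → y ∈ U × x ~ y
  cp∈ x y∈ = ∈-filterᵇ⁻ (ρ n x) U y∈

  cp-resp : ∀ x y → x ∈ U → y ∈ U → x ~ y → cp x ≡ cp y
  cp-resp x y xU yU x~y = filter-cong _ _ U (λ z zU → bool-ext
    (λ x~z → ~-trans y x z yU zU (~-sym x y yU x~y) x~z)
    (λ y~z → ~-trans x y z xU zU x~y y~z))

  -- The mirrored rank is a legal rank, so the search in Defs succeeds.
  mirrorRank-attained : ∀ x → x ∈ U → Σ ℕ λ y → y ∈ cp x × rank (cp x) y ≡ mirrorRank (cp x) x
  mirrorRank-attained x xU = rank-surjective c (cp-unique x) (mirrorRank c x)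
      (m<n⇒0<n∸m (s≤s (rank-≤ c x))) (∸-monoʳ-≤ (suc (length c)) (rank-pos c (∈cp x xU)))
    where c = cp x

  μ-spec : ∀ x → x ∈ U → μ x ∈ cp x × rank (cp x) (μ x) ≡ mirrorRank (cp x) x
  μ-spec x xU rewrite mirror-search U qe x with findᵇ (λ y → rank (cp x) y ≡ᵇ mirrorRank (cp x) x) (cp x) in found
  ... | just y = let (y∈ , ry) = findᵇ-just _ (cp x) found in y∈ , ≡ᵇ-true⁻ ry
  ... | nothing with mirrorRank-attained x xU
  ... | y , y∈ , ry = ⊥-elim (bool-clash (≡ᵇ-true ry) (findᵇ-nothing _ (cp x) found y y∈))

  μU : ∀ x → x ∈ U → μ x ∈ U
  μU x xU = proj₁ (cp∈ x (proj₁ (μ-spec x xU)))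

  ~μ : ∀ x → x ∈ U → x ~ μ x
  ~μ x xU = proj₂ (cp∈ x (proj₁ (μ-spec x xU)))

  μ-rank : ∀ x y → x ∈ U → y ∈ U → x ~ y → rank (cp x) (μ y) ≡ mirrorRank (cp x) y
  μ-rank x y xU yU x~y = subst (λ c → rank c (μ y) ≡ mirrorRank c y)
    (sym (cp-resp x y xU yU x~y)) (proj₂ (μ-spec y yU))

  μ-involutive : ∀ x → x ∈ U → μ (μ x) ≡ x
  μ-involutive x xU = rank-injective c μμx∈c (∈cp x xU) (begin
      rank c (μ (μ x))                      ≡⟨ μ-rank x (μ x) xU (μU x xU) (~μ x xU) ⟩
      suc (length c) ∸ rank c (μ x)         ≡⟨ cong (suc (length c) ∸_) (proj₂ (μ-spec x xU)) ⟩
      suc (length c) ∸ mirrorRank c x      ≡⟨ m∸[m∸n]≡n (m≤n⇒m≤1+n (rank-≤ c x)) ⟩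
      rank c x                              ∎)
    where
    open ≡-Reasoning
    c = cp x
    μμx∈c : μ (μ x) ∈ c
    μμx∈c = subst (μ (μ x) ∈_) (sym (cp-resp x (μ x) xU (μU x xU) (~μ x xU))) (proj₁ (μ-spec (μ x) (μU x xU)))

  μ-injective : ∀ x y → x ∈ U → y ∈ U → μ x ≡ μ y → x ≡ y
  μ-injective x y xU yU e = trans (sym (μ-involutive x xU)) (trans (cong μ e) (μ-involutive y yU))

  μ-reverses : ∀ x y → x ∈ U → y ∈ U → x ~ y → x < y → μ y < μ x
  μ-reverses x y xU yU x~y x<y with μ x ≤? μ y
  ... | no μx≰μy = ≰⇒> μx≰μy
  ... | yes μx≤μy = ⊥-elim (<⇒≱ rank-gap (rank-mono c μx≤μy))
    where
    c = cp x
    y∈c : y ∈ c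
    y∈c = subst (y ∈_) (sym (cp-resp x y xU yU x~y)) (∈cp y yU)
    rank-gap : rank c (μ y) < rank c (μ x)
    rank-gap rewrite μ-rank x y xU yU x~y | proj₂ (μ-spec x xU) =
      ∸-monoʳ-< (rank-strict c x<y y∈c) (m≤n⇒m≤1+n (rank-≤ c y))

  μ-resp-~ : ∀ x y → x ∈ U → y ∈ U → x ~ y → μ x ~ μ y
  μ-resp-~ x y xU yU x~y = ~-trans (μ x) x (μ y) (μU x xU) (μU y yU) (~-sym x (μ x) (μU x xU) (~μ x xU))
    (~-trans x y (μ y) xU (μU y yU) x~y (~μ y yU))

dualEdges : List ℕ → (ℕ → ℕ → Bool) → ℕ → ℕ → Bool
dualEdges U qe x y =
  if mirror U qe x <ᵇ mirror U qe y then qe (mirror U qe x) (mirror U qe y) else qe (mirror U qe y) (mirror U qe x)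

lookup-agree : ∀ U q₁ q₂ → Agree U q₁ q₂ → ∀ a b → a ∈ U → b ∈ U → a ≢ b →
  (if a <ᵇ b then q₁ a b else q₁ b a) ≡ (if a <ᵇ b then q₂ a b else q₂ b a)
lookup-agree U q₁ q₂ ag a b aU bU a≢b with a <ᵇ b in a<b
... | true = ag a b aU bU (<ᵇ-true⁻ a<b)
... | false = ag b a bU aU (<ᵇ-false⇒> a≢b a<b)

module Duality (U : List ℕ) (uU : Unique U) (qe : ℕ → ℕ → Bool) where
  open Mirror U uU qe public

  qe' : ℕ → ℕ → Bool
  qe' = dualEdges U qe

  module D = Mirror U uU qe'

  adj'≡ : ∀ y z → y ∈ U → z ∈ U → D.adj y z ≡ adj (μ y) (μ z)
  adj'≡ y z yU zU with y ≟ z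
  ... | yes refl rewrite <ᵇ-false {y} {y} (<-irrefl refl) | <ᵇ-false {μ y} {μ y} (<-irrefl refl) = refl
  ... | no y≢z = begin
      D.adj y z                                          ≡⟨ or-as-if y z qe' y≢z ⟩
      (if y <ᵇ z then qe' y z else qe' z y)             ≡⟨ cong (if y <ᵇ z then qe' y z else_) qe'-sym ⟩
      (if y <ᵇ z then qe' y z else qe' y z)             ≡⟨ if-same (y <ᵇ z) _ ⟩
      qe' y z                                            ≡⟨ sym (or-as-if (μ y) (μ z) qe μy≢μz) ⟩
      adj (μ y) (μ z)                                    ∎
    where
    open ≡-Reasoning
    μy≢μz : μ y ≢ μ z
    μy≢μz e = y≢z (μ-injective y z yU zU e)
    qe'-sym : qe' z y ≡ qe' y z
    qe'-sym = if-swap (μ y) (μ z) (qe (μ z) (μ y)) (qe (μ y) (μ z)) μy≢μz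

  -- Since μ is an involution preserving _~_, it also reflects it.
  ~-from-μ : ∀ x y → x ∈ U → y ∈ U → μ x ~ μ y → x ~ y
  ~-from-μ x y xU yU e = subst₂ _~_ (μ-involutive x xU) (μ-involutive y yU)
    (μ-resp-~ (μ x) (μ y) (μU x xU) (μU y yU) e)

  -- F' and F have the same components: transport reachability along μ in both directions.
  ~'⇒~ : ∀ x y → x ∈ U → y ∈ U → x D.~ y → x ~ y
  ~'⇒~ x y xU yU e = ~-from-μ x y xU yU
    (reach-map U qe' qe μ μU (λ a b aU bU q → trans (sym (adj'≡ a b aU bU)) q) n x y yU e)

  ~⇒~' : ∀ x y → x ∈ U → y ∈ U → x ~ y → x D.~ y
  ~⇒~' x y xU yU e = subst₂ D._~_ (μ-involutive x xU) (μ-involutive y yU)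
    (reach-map U qe qe' μ μU
      (λ a b aU bU q → trans (adj'≡ (μ a) (μ b) (μU a aU) (μU b bU)) (trans (cong₂ adj (μ-involutive a aU) (μ-involutive b bU)) q))
      n (μ x) (μ y) (μU y yU) (μ-resp-~ x y xU yU e))

  cp'≡ : ∀ x → x ∈ U → D.cp x ≡ cp x
  cp'≡ x xU = filter-cong _ _ U (λ z zU → bool-ext (~'⇒~ x z xU zU) (~⇒~' x z xU zU))

  μ'≡ : ∀ x → x ∈ U → D.μ x ≡ μ x
  μ'≡ x xU = mirror-comp U qe' qe x (cp'≡ x xU)

  dual-dual-edges : Agree U (dualEdges U qe') qe
  dual-dual-edges u v uU vU u<v =
    trans (cong₂ (λ a b → if a <ᵇ b then qe' a b else qe' b a) (μ'≡ u uU) (μ'≡ v vU)) (both (μ u <ᵇ μ v))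
    where
    back : ∀ a b → a ∈ U → b ∈ U → qe' (μ a) (μ b) ≡ (if a <ᵇ b then qe a b else qe b a)
    back a b aU bU = cong₂ (λ a b → if a <ᵇ b then qe a b else qe b a) (μ-involutive a aU) (μ-involutive b bU)
    both : ∀ t → (if t then qe' (μ u) (μ v) else qe' (μ v) (μ u)) ≡ qe u v
    both true rewrite back u v uU vU | <ᵇ-true u<v = refl
    both false rewrite back v u vU uU | <ᵇ-false (<⇒≯ u<v) = refl

  dual-edge : ∀ u v → u ∈ U → v ∈ U → u < v → qe' u v ≡ true → μ v < μ u × qe (μ v) (μ u) ≡ true
  dual-edge u v uU vU u<v q with μ u <ᵇ μ v in ord
  ... | true = ⊥-elim (<-asym (<ᵇ-true⁻ ord) (μ-reverses u v uU vU u~v u<v))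
    where
    u~v : u ~ v
    u~v = ~-from-μ u v uU vU (adj⇒~ (μ u) (μ v) (μU u uU) (μU v vU) (∨-introˡ _ (∧-intro ord q)))
  ... | false = <ᵇ-false⇒> (λ e → <-irrefl (μ-injective u v uU vU e) u<v) ord , q

flipT-involutive : ∀ t → flipT (flipT t) ≡ t
flipT-involutive t1 = refl
flipT-involutive t2 = refl

isT1-flipT : ∀ t → isT1 (flipT t) ≡ isT2 t
isT1-flipT t1 = refl
isT1-flipT t2 = refl

isT2-flipT : ∀ t → isT2 (flipT t) ≡ isT1 t
isT2-flipT t1 = refl
isT2-flipT t2 = refl

module DualInvolution (U : List ℕ) (uU : Unique U) {H : Graph} where

  ≈-sym : {T S : QT H} → T ≈[ U ] S → S ≈[ U ] T
  ≈-sym (a , b , c) = (λ x xU → sym (a x xU)) , (λ e → sym (b e)) , (λ u v uU vU u<v → sym (c u v uU vU u<v))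

  ≈-trans : {T S W : QT H} → T ≈[ U ] S → S ≈[ U ] W → T ≈[ U ] W
  ≈-trans (a , b , c) (a' , b' , c') = (λ x xU → trans (a x xU) (a' x xU)) , (λ e → trans (b e) (b' e))
    , (λ u v uU vU u<v → trans (c u v uU vU u<v) (c' u v uU vU u<v))

  dual-dual : (T : QT H) → dual U (dual U T) ≈[ U ] T
  dual-dual T = (λ x xU → trans (cong (λ w → flipT (flipT (tier T w))) (trans (cong μ (μ'≡ x xU)) (μ-involutive x xU)))
                              (flipT-involutive (tier T x)))
              , (λ e → refl)
              , dual-dual-edges
    where open Duality U uU (qE T)

  -- The dual only depends on T up to ≈[ U ] (as μ only depends on the forest).
  dual-cong : (T S : QT H) → T ≈[ U ] S → dual U T ≈[ U ] dual U S
  dual-cong T S (tiers , hEs , qEs) = tiers' , hEs , qEs'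
    where
    open Mirror U uU (qE T)
    μS≡μ : ∀ x → mirror U (qE S) x ≡ μ x
    μS≡μ x = mirror-comp U (qE S) (qE T) x (sym (comp-cong U (qE T) (qE S) qEs x))
    tiers' : ∀ x → x ∈ U → tier (dual U T) x ≡ tier (dual U S) x
    tiers' x xU rewrite μS≡μ x = cong flipT (tiers (μ x) (μU x xU))
    qEs' : Agree U (qE (dual U T)) (qE (dual U S))
    qEs' u v uU vU u<v rewrite μS≡μ u | μS≡μ v =
      lookup-agree U (qE T) (qE S) qEs (μ u) (μ v) (μU u uU) (μU v vU) (λ e → <-irrefl (μ-injective u v uU vU e) u<v)

  -- Injectivity of T ↦ T*: apply the dual once more.
  dual-injective : (T S : QT H) → dual U T ≈[ U ] dual U S → T ≈[ U ] S
  dual-injective T S h = ≈-trans (≈-sym (dual-dual T)) (≈-trans (dual-cong (dual U T) (dual U S) h) (dual-dual S))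

module Walks {H : Graph} where

  wapp : ∀ {P : Edge H → Set} {x y z} → Walk P x y → Walk P y z → Walk P x z
  wapp stop q = q
  wapp (step e p j w) q = step e p j (wapp w q)

  wmap : ∀ {P Q : Edge H → Set} → (∀ e → P e → Q e) → ∀ {x y} → Walk P x y → Walk Q x y
  wmap f stop = stop
  wmap f (step e p j w) = step e (f e p) j (wmap f w)

  joins-sym : ∀ {e : Edge H} {x z} → Joins e x z → Joins e z x
  joins-sym (inj₁ a) = inj₂ a
  joins-sym (inj₂ a) = inj₁ a

  wrev : ∀ {P : Edge H → Set} {x y} → Walk P x y → Walk P y x
  wrev stop = stop
  wrev (step e p j w) = wapp (wrev w) (step e p (joins-sym {e} j) stop)

  wone : ∀ {P : Edge H → Set} (e : Edge H) → P e → ∀ {x z} → Joins e x z → Walk P x z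
  wone e p j = step e p j stop

  wsubst : ∀ {P Q : Edge H → Set} → (∀ f → P f → ∀ {x z} → Joins f x z → Walk Q x z) →
    ∀ {x y} → Walk P x y → Walk Q x y
  wsubst g stop = stop
  wsubst g (step e p j w) = wapp (g e p j) (wsubst g w)

  reorient : ∀ {Q : Edge H → Set} (e : Edge H) {a b x z} → Joins e a b → Joins e x z → Walk Q a b → Walk Q x z
  reorient e (inj₁ p) (inj₁ q) w with trans (sym p) q
  ... | refl = w
  reorient e (inj₁ p) (inj₂ q) w with trans (sym p) q
  ... | refl = wrev w
  reorient e (inj₂ p) (inj₁ q) w with trans (sym p) q
  ... | refl = wrev w
  reorient e (inj₂ p) (inj₂ q) w with trans (sym p) q
  ... | refl = w

  edge≟ : (e f : Edge H) → Dec (e ≡ f)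
  edge≟ (hEdge i) (hEdge j) with i Fin.≟ j
  ... | yes refl = yes refl
  ... | no i≢j = no λ { refl → i≢j refl }
  edge≟ (hEdge i) (qEdge _ _) = no λ ()
  edge≟ (qEdge _ _) (hEdge _) = no λ ()
  edge≟ (qEdge a b) (qEdge c d) with a ≟ c | b ≟ d
  ... | yes refl | yes refl = yes refl
  ... | no a≢c | _ = no λ { refl → a≢c refl }
  ... | _ | no b≢d = no λ { refl → b≢d refl }

  Minus : (Edge H → Set) → Edge H → Edge H → Set
  Minus P e f = P f × f ≢ e

  -- An edge whose ends are joined by a walk avoiding it can be deleted without
  -- disconnecting; so in a spanning tree no such walk exists.
  reroute : ∀ {P : Edge H → Set} → Connected H P → (e : Edge H) → ∀ {a b} → Joins e a b →
    Walk (Minus P e) a b → Connected H (Minus P e)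
  reroute {P} con e {a} {b} j w x y xV yV = wsubst detour (con x y xV yV)
    where
    detour : ∀ f → P f → ∀ {x z} → Joins f x z → Walk (Minus P e) x z
    detour f p jf with edge≟ f e
    ... | yes refl = reorient e j jf w
    ... | no f≢e = wone f (p , f≢e) jf

  no-detour : ∀ {P : Edge H → Set} → IsSpanningTree H P → ∀ e → P e → ∀ {a b} → Joins e a b →
    ¬ Walk (Minus P e) a b
  no-detour (con , min) e p j w = min e p (reroute con e j w)

open Walks

Ends : ℕ → ℕ → ℕ → ℕ → Set
Ends c d x z = (c ≡ x × d ≡ z) ⊎ (c ≡ z × d ≡ x)

joins⇒ends : ∀ {H : Graph} {c d x z} → Joins {H} (qEdge c d) x z → Ends c d x z
joins⇒ends (inj₁ e) = inj₁ (,-injectiveˡ e , ,-injectiveʳ e)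
joins⇒ends (inj₂ e) = inj₂ (,-injectiveˡ e , ,-injectiveʳ e)

ends⇒joins : ∀ {H : Graph} {c d x z} → Ends c d x z → Joins {H} (qEdge c d) x z
ends⇒joins (inj₁ (refl , refl)) = inj₁ refl
ends⇒joins (inj₂ (refl , refl)) = inj₂ refl

ends-to : ∀ (Q : ℕ → Set) {c d x z} → Ends c d x z → Q x → Q z → Q c × Q d
ends-to Q (inj₁ (refl , refl)) qx qz = qx , qz
ends-to Q (inj₂ (refl , refl)) qx qz = qz , qx

ends-from : ∀ (Q : ℕ → Set) {c d x z} → Ends c d x z → Q c → Q d → Q x × Q z
ends-from Q (inj₁ (refl , refl)) qc qd = qc , qd
ends-from Q (inj₂ (refl , refl)) qc qd = qd , qc

same-edge : ∀ {H : Graph} {c d c' d' x z y y'} → qEdge {H} c d ≡ qEdge c' d' →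
  Ends c d x z → Ends c' d' y y' → Ends x z y y'
same-edge refl (inj₁ (refl , refl)) (inj₁ (refl , refl)) = inj₁ (refl , refl)
same-edge refl (inj₁ (refl , refl)) (inj₂ (refl , refl)) = inj₂ (refl , refl)
same-edge refl (inj₂ (refl , refl)) (inj₁ (refl , refl)) = inj₂ (refl , refl)
same-edge refl (inj₂ (refl , refl)) (inj₂ (refl , refl)) = inj₁ (refl , refl)

ends-ordered : ∀ {c d x z u v} → Ends c d x z → Ends x z u v → c < d → u < v → c ≡ u × d ≡ v
ends-ordered (inj₁ (refl , refl)) (inj₁ (refl , refl)) _ _ = refl , refl
ends-ordered (inj₁ (refl , refl)) (inj₂ (refl , refl)) c<d u<v = ⊥-elim (<-asym c<d u<v)
ends-ordered (inj₂ (refl , refl)) (inj₁ (refl , refl)) c<d u<v = ⊥-elim (<-asym c<d u<v)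
ends-ordered (inj₂ (refl , refl)) (inj₂ (refl , refl)) _ _ = refl , refl

adjF-edge : ∀ U qe y z → adjF U qe y z ≡ true → Σ ℕ λ c → Σ ℕ λ d → Ends c d y z × c < d × qe c d ≡ true
adjF-edge U qe y z a with ∨-true {(y <ᵇ z) ∧ qe y z} a
... | inj₁ a₁ = let (y<z , q) = ∧-true {y <ᵇ z} a₁ in y , z , inj₁ (refl , refl) , <ᵇ-true⁻ y<z , q
... | inj₂ a₂ = let (z<y , q) = ∧-true {z <ᵇ y} a₂ in z , y , inj₂ (refl , refl) , <ᵇ-true⁻ z<y , q

ends-adjF : ∀ U qe {c d x z} → Ends c d x z → c < d → qe c d ≡ true → adjF U qe x z ≡ true
ends-adjF U qe (inj₁ (refl , refl)) c<d q = ∨-introˡ _ (∧-intro (<ᵇ-true c<d) q)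
ends-adjF U qe {c} {d} (inj₂ (refl , refl)) c<d q =
  trans (adjF-sym U qe d c) (∨-introˡ _ (∧-intro (<ᵇ-true c<d) q))

module SpanningTrees (U : List ℕ) (uU : Unique U) {H : Graph} (UV : All (_∈ verts H) U) where

  forest-edge : (T : QT H) → ∀ {y z} → y ∈ U → z ∈ U → adjF U (qE T) y z ≡ true →
    Σ ℕ λ c → Σ ℕ λ d → Ends c d y z × InT U T (qEdge c d)
  forest-edge T {y} {z} yU zU a with adjF-edge U (qE T) y z a
  ... | c , d , ends-cd , c<d , q = c , d , ends-cd , proj₁ (ends-to (_∈ U) ends-cd yU zU) , proj₂ (ends-to (_∈ U) ends-cd yU zU) , c<d , q

  lift-path : ∀ {E : ℕ → ℕ → Set} {Q : Edge H → Set} →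
    (∀ {y z} → E y z → Σ (Edge H) λ f → Q f × Joins f y z) → ∀ {x y} → Path E x y → Walk Q x y
  lift-path realise pnil = stop
  lift-path realise (pcons e p) = let (f , q , j) = realise e in step f q j (lift-path realise p)

  -- Walks move from T₁ to T₂ when both have the same H-edges and every component of F₁
  -- lies in a component of F₂; Q-edges of F₁ are replaced by paths in F₂.
  transfer : (T₁ T₂ : QT H) → (∀ i → hE T₁ i ≡ hE T₂ i) →
    (∀ u v → u ∈ U → v ∈ U → Components._~_ U (qE T₁) u v → Components._~_ U (qE T₂) u v) →
    (Ok : Edge H → Set) → (∀ c d → Ok (qEdge c d)) →
    ∀ {x y} → Walk (λ f → InT U T₁ f × Ok f) x y → Walk (λ f → InT U T₂ f × Ok f) x y
  transfer T₁ T₂ same-hE ~₁⇒~₂ Ok ok = wsubst replace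
    where
    module C₁ = Components U (qE T₁)
    module C₂ = Components U (qE T₂)
    replace : ∀ f → InT U T₁ f × Ok f → ∀ {x z} → Joins f x z → Walk (λ f → InT U T₂ f × Ok f) x z
    replace (hEdge i) (p , okf) j = wone (hEdge i) (trans (sym (same-hE i)) p , okf) j
    replace (qEdge u v) ((uU , vU , u<v , q) , okf) j = reorient (qEdge u v) (inj₂ refl) j
        (lift-path realise (C₂.ball-path C₂.n u v uU vU u~₂v))
      where
      u~₂v : C₂._~_ u v
      u~₂v = ~₁⇒~₂ u v uU vU (C₁.adj⇒~ u v uU vU (ends-adjF U (qE T₁) (inj₁ (refl , refl)) u<v q))
      realise : ∀ {y z} → C₂.BallEdge C₂.n u y z → Σ (Edge H) λ f → (InT U T₂ f × Ok f) × Joins f y z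
      realise (a , yU , zU , _ , _) with forest-edge T₂ yU zU a
      ... | c , d , ends-cd , p = qEdge c d , (p , ok c d) , ends⇒joins {H} ends-cd

  module Dualise (T : QT H) where
    open Duality U uU (qE T) public

    T* : QT H
    T* = dual U T

    -- T* is connected if T is: each Q-edge of T is replaced by a path of F'.
    conn* : Connected H (InT U T) → Connected H (InT U T*)
    conn* con x y xV yV = wmap (λ _ → proj₁)
      (transfer T T* (λ _ → refl) ~⇒~' (λ _ → ⊤) (λ _ _ → tt) (wmap (λ _ p → p , tt) (con x y xV yV)))

    module Minimal (tree : IsSpanningTree H (InT U T)) where

      -- Deleting an H-edge from T* disconnects it, because the same holds in T.
      minimal-hEdge : ∀ i → hE T i ≡ true → ¬ Connected H (Minus (InT U T*) (hEdge i))
      minimal-hEdge i p con* = proj₂ tree (hEdge i) p (λ x y xV yV →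
        transfer T* T (λ _ → refl) ~'⇒~ (λ f → f ≢ hEdge i) (λ c d ()) (con* x y xV yV))

      Outside : ℕ → Edge H → Set
      Outside u (hEdge i) = hE T i ≡ true
      Outside u (qEdge c d) = InT U T (qEdge c d) × ¬ (u ~ c)

      -- A walk outside the component of u cannot join two distinct vertices of that component:
      -- together with the F-path between them it would contain a cycle of T.
      sealed : ∀ u w x → u ∈ U → w ∈ U → x ∈ U → u ~ w → u ~ x → Walk (Outside u) w x → w ≡ x
      sealed u w x uU wU xU u~w u~x γ with w ≟ x
      ... | yes w≡x = w≡x
      ... | no w≢x with closer-neighbour w x (~-trans w u x wU xU (~-sym u w wU u~w) u~x) (λ e → w≢x (sym e))
      ... | k , z , zU , ρz , ρx≡false , a with forest-edge T xU zU a
      ... | c , d , ends-cd , xz∈T = ⊥-elim (no-detour tree (qEdge c d) xz∈T (ends⇒joins {H} ends-cd) (wapp x-to-w w-to-z))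
        where
        u~c : u ~ c
        u~c = proj₁ (ends-to (u ~_) ends-cd u~x (~-trans u x z uU zU u~x (adj⇒~ x z xU zU a)))
        avoid : ∀ f → Outside u f → Minus (InT U T) (qEdge c d) f
        avoid (hEdge i) p = p , λ ()
        avoid (qEdge c' d') (p , u≁c') = p , λ { refl → u≁c' u~c }
        x-to-w : Walk (Minus (InT U T) (qEdge c d)) x w
        x-to-w = wrev (wmap avoid γ)
        realise : ∀ {y y'} → BallEdge k w y y' → Σ (Edge H) λ f → Minus (InT U T) (qEdge c d) f × Joins f y y'
        realise (a' , yU , y'U , ρy , ρy') with forest-edge T yU y'U a'
        ... | c' , d' , ends-cd' , p = qEdge c' d' , (p , not-xz) , ends⇒joins {H} ends-cd'
          where
          not-xz : qEdge c' d' ≢ qEdge c d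
          not-xz eq with same-edge eq ends-cd' ends-cd
          ... | inj₁ (refl , _) = bool-clash ρy ρx≡false
          ... | inj₂ (_ , refl) = bool-clash ρy' ρx≡false
        w-to-z : Walk (Minus (InT U T) (qEdge c d)) w z
        w-to-z = wrev (lift-path realise (ball-path k w z wU zU ρz))

      -- Deleting a Q-edge e = u v (u < v) from T* disconnects it.  Otherwise walk from u to v
      -- in T* − e; cutting excursions through u's component (via sealed) leaves a path of
      -- F' − e from u to v, whose μ-image is a walk in T − μ(e) between the ends of μ(e).
      module QEdge (u v : ℕ) (uU : u ∈ U) (vU : v ∈ U) (u<v : u < v) (uv∈F' : qe' u v ≡ true) where

        e : Edge H
        e = qEdge u v

        DualStep : ℕ → ℕ → Set
        DualStep y z = y ∈ U × z ∈ U × D.adj y z ≡ true × ¬ Ends y z u v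

        dual-path-~ : ∀ {w} → Path DualStep u w → w ∈ U × u ~ w
        dual-path-~ π = ptransport (λ y → y ∈ U × u ~ y)
          (λ (yU , zU , a , _) (_ , u~y) → zU , ~-trans u _ _ uU zU u~y (~'⇒~ _ _ yU zU (D.adj⇒~ _ _ yU zU a)))
          π (uU , ~-refl u)

        Reached : ℕ → Set
        Reached x = Σ ℕ λ w → Path DualStep u w × Walk (Outside u) w x

        reached-hEdge : ∀ i {x z} → hE T i ≡ true → Joins {H} (hEdge i) x z → Reached x → Reached z
        reached-hEdge i p j (w , π , γ) = w , π , wapp γ (wone (hEdge i) p j)

        -- An F'-edge c d outside u's component is replaced by the F-path between c and d.
        reached-foreign : ∀ c d {x z} → c ∈ U → d ∈ U → c < d → qe' c d ≡ true → ¬ (u ~ c) →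
          Joins {H} (qEdge c d) x z → Reached x → Reached z
        reached-foreign c d cU dU c<d q u≁c j (w , π , γ) =
          w , π , wapp γ (reorient (qEdge c d) (inj₂ refl) j (lift-path realise (ball-path n c d cU dU c~d)))
          where
          c~d : c ~ d
          c~d = ~'⇒~ c d cU dU (D.adj⇒~ c d cU dU (ends-adjF U qe' (inj₁ (refl , refl)) c<d q))
          realise : ∀ {y y'} → BallEdge n c y y' → Σ (Edge H) λ f → Outside u f × Joins f y y'
          realise (a , yU , y'U , c~y , c~y') with forest-edge T yU y'U a
          ... | c' , d' , ends-cd' , p = qEdge c' d' , (p , u≁c') , ends⇒joins {H} ends-cd'
            where
            c'U = proj₁ (ends-to (_∈ U) ends-cd' yU y'U)
            u≁c' : ¬ (u ~ c')
            u≁c' u~c' = u≁c (~-trans u c' c uU cU u~c'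
              (~-sym c c' c'U (proj₁ (ends-to (c ~_) ends-cd' c~y c~y'))))

        -- An F'-edge c d ≠ e inside u's component: by sealed the walk outside is empty, and
        -- the F'-path is extended by c d.
        reached-own : ∀ c d {x z} → c ∈ U → d ∈ U → c < d → qe' c d ≡ true → qEdge c d ≢ e → u ~ c →
          Joins {H} (qEdge c d) x z → Reached x → Reached z
        reached-own c d {x} {z} cU dU c<d q cd≢e u~c j (w , π , γ) =
          z , papp (subst (Path DualStep u) w≡x π) (pcons (xU , zU , xz∈F' , not-e) pnil) , stop
          where
          ends-cd = joins⇒ends {H} j
          c~d = ~'⇒~ c d cU dU (D.adj⇒~ c d cU dU (ends-adjF U qe' (inj₁ (refl , refl)) c<d q))
          in-comp : (x ∈ U × u ~ x) × (z ∈ U × u ~ z)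
          in-comp = ends-from (λ y → y ∈ U × u ~ y) ends-cd (cU , u~c) (dU , ~-trans u c d uU dU u~c c~d)
          xU = proj₁ (proj₁ in-comp)
          zU = proj₁ (proj₂ in-comp)
          w≡x : w ≡ x
          w≡x = sealed u w x uU (proj₁ (dual-path-~ π)) xU (proj₂ (dual-path-~ π)) (proj₂ (proj₁ in-comp)) γ
          xz∈F' : D.adj x z ≡ true
          xz∈F' = ends-adjF U qe' ends-cd c<d q
          not-e : ¬ Ends x z u v
          not-e xz=uv with ends-ordered ends-cd xz=uv c<d u<v
          ... | refl , refl = cd≢e refl

        reached-step : ∀ f → Minus (InT U T*) e f → ∀ {x z} → Joins f x z → Reached x → Reached z
        reached-step (hEdge i) (p , _) = reached-hEdge i p
        reached-step (qEdge c d) ((cU , dU , c<d , q) , f≢e) with bool-cases (ρ n u c)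
        ... | inj₁ u~c = reached-own c d cU dU c<d q f≢e u~c
        ... | inj₂ u≁c = reached-foreign c d cU dU c<d q (λ u~c → bool-clash u~c u≁c)

        reached-walk : ∀ {x y} → Walk (Minus (InT U T*) e) x y → Reached x → Reached y
        reached-walk stop r = r
        reached-walk (step f p j w) r = reached-walk w (reached-step f p j r)

        FStep : ℕ → ℕ → Set
        FStep a b = a ∈ U × b ∈ U × adj a b ≡ true × ¬ Ends a b (μ u) (μ v)

        mirror-step : ∀ {y z} → DualStep y z → FStep (μ y) (μ z)
        mirror-step {y} {z} (yU , zU , a , yz≠uv) = μU y yU , μU z zU , trans (sym (adj'≡ y z yU zU)) a , not-μe
          where
          not-μe : ¬ Ends (μ y) (μ z) (μ u) (μ v)
          not-μe (inj₁ (p , q)) = yz≠uv (inj₁ (μ-injective y u yU uU p , μ-injective z v zU vU q))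
          not-μe (inj₂ (p , q)) = yz≠uv (inj₂ (μ-injective y v yU vU p , μ-injective z u zU uU q))

        minimal-qEdge : ¬ Connected H (Minus (InT U T*) e)
        minimal-qEdge con* with reached-walk (con* u v (All.lookup UV uU) (All.lookup UV vU)) (u , pnil , stop)
        ... | w , π , γ = no-detour tree μe μe∈T (inj₂ refl) (lift-path realise (pmap μ mirror-step π-to-v))
          where
          μe : Edge H
          μe = qEdge (μ v) (μ u)
          μe∈T : InT U T μe
          μe∈T = μU v vU , μU u uU , dual-edge u v uU vU u<v uv∈F'
          u~v : u ~ v
          u~v = ~'⇒~ u v uU vU (D.adj⇒~ u v uU vU (ends-adjF U qe' (inj₁ (refl , refl)) u<v uv∈F'))
          π-to-v : Path DualStep u v
          π-to-v = subst (Path DualStep u) (sealed u w v uU (proj₁ (dual-path-~ π)) vU (proj₂ (dual-path-~ π)) u~v γ) π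
          realise : ∀ {a b} → FStep a b → Σ (Edge H) λ f → Minus (InT U T) μe f × Joins f a b
          realise (aU , bU , ab∈F , ab≠μe) with forest-edge T aU bU ab∈F
          ... | c , d , ends-cd , p = qEdge c d , (p , λ eq → ab≠μe (same-edge eq ends-cd (inj₂ (refl , refl)))) , ends⇒joins {H} ends-cd

      minimal* : ∀ f → InT U T* f → ¬ Connected H (Minus (InT U T*) f)
      minimal* (hEdge i) p = minimal-hEdge i p
      minimal* (qEdge u v) (uU , vU , u<v , q) = QEdge.minimal-qEdge u v uU vU u<v q

    dual-in-union : ∀ p₁ p₂ → InSTUnion U p₁ p₂ H T → InSTUnion U p₂ p₁ H T*
    dual-in-union p₁ p₂ (count₁ , count₂ , tiered , tree) =
      count₁* , count₂* , tiered* , conn* (proj₁ tree) , Minimal.minimal* tree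
      where
      count₁* : count (λ x → isT1 (tier T* x)) U ≡ p₂
      count₁* = trans (count-cong _ _ U (λ x _ → isT1-flipT (tier T (μ x))))
                  (trans (count-involution U uU μ μU μ-involutive (isT2 ∘ tier T)) count₂)
      count₂* : count (λ x → isT2 (tier T* x)) U ≡ p₁
      count₂* = trans (count-cong _ _ U (λ x _ → isT2-flipT (tier T (μ x))))
                  (trans (count-involution U uU μ μU μ-involutive (isT1 ∘ tier T)) count₁)
      tiered* : ∀ u v → u ∈ U → v ∈ U → u < v → qE T* u v ≡ true → (tier T* u ≡ t1) × (tier T* v ≡ t2)
      tiered* u v uU vU u<v q with dual-edge u v uU vU u<v q
      ... | μv<μu , q' with tiered (μ v) (μ u) (μU v vU) (μU u uU) μv<μu q'
      ... | μv-t1 , μu-t2 = cong flipT μu-t2 , cong flipT μv-t1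

-- The map T ↦ T* lands in the union for p' = (p₂, p₁), is injective, and is onto since
-- every S of that union is the dual of S*.
proposition2p3 : (U : List ℕ) → Unique U → U ≢ [] → All (λ u → 0 < u) U →
    (p₁ p₂ : ℕ) → 0 < p₁ → 0 < p₂ → p₁ + p₂ ≡ length U →
    (H : Graph) → All (λ u → u ∈ verts H) U →
    ((T : QT H) → InSTUnion U p₁ p₂ H T → InSTUnion U p₂ p₁ H (dual U T)) ×
    ((T S : QT H) → InSTUnion U p₁ p₂ H T → InSTUnion U p₁ p₂ H S →
       dual U T ≈[ U ] dual U S → T ≈[ U ] S) ×
    ((S : QT H) → InSTUnion U p₂ p₁ H S →
       Σ (QT H) (λ T → InSTUnion U p₁ p₂ H T × dual U T ≈[ U ] S))
proposition2p3 U uU _ _ p₁ p₂ _ _ _ H UV =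
  (λ T → dual-in-union T p₁ p₂) ,
  (λ T S _ _ → dual-injective T S) ,
  (λ S S∈ → dual U S , dual-in-union S p₂ p₁ S∈ , dual-dual S)
  where
  open DualInvolution U uU {H}
  dual-in-union : (T : QT H) → ∀ p₁ p₂ → InSTUnion U p₁ p₂ H T → InSTUnion U p₂ p₁ H (dual U T)
  dual-in-union T = SpanningTrees.Dualise.dual-in-union U uU UV T
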